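{- Let $i \geq 1$ and $n \geq 1$ be integers, and let $F_i, F_{i+1}, F_{i+2}$ denote the $i$-th, $(i+1)$-th and $(i+2)$-th Fibonacci numbers. Define integers $B'_1, C'_2, A'_3$ by \begin{itemize} \item $B'_1 \equiv (-1)^i n F_{i-2} \pmod{F_i}$ with $1 \leq B'_1 \leq F_i$; \item $C'_2 \equiv (-1)^i n F_{i} \pmod{F_{i+1}}$ with $1 \leq C'_2 \leq F_{i+1}$; \item $A'_3 \equiv (-1)^i n F_{i+1} \pmod{F_{i+2}}$ with $1 \leq A'_3 \leq F_{i+2}$, \end{itemize} and set \begin{align*} N_2 = {} & n(n+F_i+F_{i+1}+F_{i+2}) + F_{i+2}F_{i+1}B'_1\bigl(F_i+1-(B'_1-1)\bigr) + F_iF_{i+2}C'_2\bigl(F_{i+1}+1-(C'_2-1)\bigr) \\ & + F_{i+1}F_iA'_3\bigl(F_{i+2}+1-(F_{i+2}-1)(A'_3-1)\bigr). \end{align*} Then the number $N(F_i,F_{i+1},F_{i+2};n)$ of triples $(x,y,z)$ of non-negative integers satisfying $F_i x + F_{i+1} y + F_{i+2} z = n$ is $$N(F_i,F_{i+1},F_{i+2};n)=\frac{N_2}{2F_iF_{i+1}F_{i+2}}+\frac{(A'_3-1)(A'_3-2)}{2} - 2.$$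
   Context: Fibonacci numbers: $F_0=0$, $F_1=1$, $F_{k+1}=F_k+F_{k-1}$, extended to negative indices by the same recurrence (so $F_{ -1}=1$). For $i=1$ the modulus $F_1=1$, so the value of $F_{ -1}$ plays no role. -}

module Defs where

open import Data.Nat as ℕ using (ℕ; zero; suc; _≟_)
open import Data.Integer as ℤ using (ℤ; +_; -[1+_])
open import Data.List using (List; length; filter; upTo; concatMap; map)
open import Data.Product using (_×_; _,_)

fib : ℕ → ℕ
fib zero = 0
fib (suc zero) = 1
fib (suc (suc k)) = fib (suc k) ℕ.+ fib k

F : ℕ → ℤ
F k = + fib k

-- F_{i-2} for i : ℕ, using the extension to negative indices
-- by the same recurrence: F_{-1} = 1, F_{-2} = -1.
Fm2 : ℕ → ℤ
Fm2 zero = -[1+ 0 ]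
Fm2 (suc zero) = + 1
Fm2 (suc (suc k)) = + fib k

sgn : ℕ → ℤ
sgn zero = + 1
sgn (suc k) = ℤ.- sgn k

triples : ℕ → List (ℕ × ℕ × ℕ)
triples n = concatMap (λ x → concatMap (λ y → map (λ z → (x , y , z)) (upTo (suc n))) (upTo (suc n))) (upTo (suc n))

-- N(a,b,c;n): number of triples of non-negative integers (x,y,z)
-- with a x + b y + c z = n.  For a,b,c ≥ 1 every solution has
-- x,y,z ≤ n, so enumerating [0..n]^3 counts all solutions.
N : ℕ → ℕ → ℕ → ℕ → ℕ
N a b c n = length (filter (λ { (x , y , z) → (a ℕ.* x ℕ.+ b ℕ.* y ℕ.+ c ℕ.* z) ≟ n }) (triples n))

-- Write a = F_i, b = F_{i+1} and c = a + b.  For coprime a, b and m ≥ -a, the equation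
-- a x + b y = m has ⌊γ/b⌋ + ⌊β/a⌋ solutions in non-negative integers whenever
-- m + a b = a γ + b β.  Counting a x + b y + c z = n layer by layer in z replaces (γ , β)
-- by (γ - 1 , β - 1) at each layer, so 2 N(a,b,c;n) = S_b(γ) + S_a(β) with
-- S_m(x) = 2 Σ_{0 ≤ j ≤ x} ⌊j/m⌋; the normalisation 1 ≤ β - γ + b ≤ c is what makes
-- S_b(γ) + S_a(β) vanish once the right-hand side becomes negative.  Cassini's identity
-- F_{i+1} F_{i-1} - F_i² = (-1)^i solves the three congruences of the statement
-- explicitly: it yields such γ, β with remainders b - C′₂ and a - B′₁ and β - γ + b = A′₃,
-- and expanding S_b(γ) + S_a(β) in these quantities is the paper's formula.

module Submission where

open import Defs
open import Data.Nat as ℕ using (ℕ; _≥_)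
open import Data.Integer as ℤ using (ℤ; +_; _+_; _-_; _*_; _≤_)
open import Data.Integer.Divisibility using (_∣_)
open import Data.Product using (_×_)
open import Relation.Binary.PropositionalEquality using (_≡_)

open import Data.Empty using (⊥-elim)
open import Data.Integer using (-[1+_]; 0ℤ; 1ℤ; -1ℤ; -_; _<_; +≤+; +<+; -≤-; Positive; positive)
import Data.Integer.Coprimality as ℤ using (coprime-divisor)
import Data.Integer.Divisibility.Signed as Signed
open import Data.Integer.Properties
open import Data.Integer.Tactic.RingSolver using (solve-∀)
open import Data.List using (List; length; filter; map; concatMap; applyUpTo; upTo; _++_)
open import Data.List.Properties using (length-++; filter-++)
open import Data.Nat using (zero; suc; NonZero; z≤n; s≤s)
open import Data.Nat.Coprimality as Coprimality using (Coprime)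
open import Data.Nat.Divisibility using (∣⇒≤)
import Data.Nat.Properties as ℕ
open import Algebra.Properties.CommutativeSemigroup ℕ.+-commutativeSemigroup using (interchange)
open import Data.Product using (_,_)
open import Function using (_∘_; id)
open import Relation.Binary.PropositionalEquality
  using (refl; sym; trans; cong; cong₂; subst; subst₂; module ≡-Reasoning)
open import Relation.Nullary using (Dec; yes; no; ¬_; contradiction)
open import Relation.Unary using (Pred; Decidable)

-- Finite sums

𝟙 : ∀ {p} {P : Set p} → Dec P → ℕ
𝟙 (yes _) = 1
𝟙 (no _)  = 0

𝟙-yes : ∀ {p} {P : Set p} → P → (P? : Dec P) → 𝟙 P? ≡ 1
𝟙-yes _ (yes _) = refl
𝟙-yes p (no ¬p) = ⊥-elim (¬p p)

𝟙-no : ∀ {p} {P : Set p} → ¬ P → (P? : Dec P) → 𝟙 P? ≡ 0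
𝟙-no ¬p (yes p) = ⊥-elim (¬p p)
𝟙-no _  (no _)  = refl

𝟙-cong : ∀ {p q} {P : Set p} {Q : Set q} → (P → Q) → (Q → P) → (P? : Dec P) (Q? : Dec Q) → 𝟙 P? ≡ 𝟙 Q?
𝟙-cong P⇒Q _   (yes p) Q? = sym (𝟙-yes (P⇒Q p) Q?)
𝟙-cong _   Q⇒P (no ¬p) Q? = sym (𝟙-no (¬p ∘ Q⇒P) Q?)

∑< : ℕ → (ℕ → ℕ) → ℕ
∑< zero    f = 0
∑< (suc L) f = f 0 ℕ.+ ∑< L (f ∘ suc)

syntax ∑< L (λ x → e) = ∑[ x < L ] e

∑-cong : ∀ L {f g : ℕ → ℕ} → (∀ x → f x ≡ g x) → ∑< L f ≡ ∑< L g
∑-cong zero    f≗g = refl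
∑-cong (suc L) f≗g = cong₂ ℕ._+_ (f≗g 0) (∑-cong L (f≗g ∘ suc))

∑-zero : ∀ L {f : ℕ → ℕ} → (∀ x → f x ≡ 0) → ∑< L f ≡ 0
∑-zero zero    f≗0 = refl
∑-zero (suc L) f≗0 = cong₂ ℕ._+_ (f≗0 0) (∑-zero L (f≗0 ∘ suc))

∑-+ : ∀ L (f g : ℕ → ℕ) → ∑[ x < L ] (f x ℕ.+ g x) ≡ ∑< L f ℕ.+ ∑< L g
∑-+ zero    f g = refl
∑-+ (suc L) f g = trans (cong (f 0 ℕ.+ g 0 ℕ.+_) (∑-+ L (f ∘ suc) (g ∘ suc))) (interchange (f 0) (g 0) _ _)

∑-comm : ∀ X Y (f : ℕ → ℕ → ℕ) → ∑[ x < X ] ∑< Y (f x) ≡ ∑[ y < Y ] ∑[ x < X ] f x y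
∑-comm zero    Y f = sym (∑-zero Y λ _ → refl)
∑-comm (suc X) Y f = trans (cong (∑< Y (f 0) ℕ.+_) (∑-comm X Y (f ∘ suc))) (sym (∑-+ Y (f 0) _))

∑-peel : ∀ X (f : ℤ → ℕ) m k → ∑[ x < suc X ] f (m - k * + x) ≡ f m ℕ.+ ∑[ x < X ] f (m - k - k * + x)
∑-peel X f m k = cong₂ ℕ._+_ (cong f (m-k*0≡m m k)) (∑-cong X λ x → cong f (m-k*[1+x]≡m-k-k*x m k (+ x)))
  where
  m-k*0≡m : ∀ m k → m - k * 0ℤ ≡ m
  m-k*0≡m = solve-∀
  m-k*[1+x]≡m-k-k*x : ∀ m k x → m - k * (1ℤ + x) ≡ m - k - k * x
  m-k*[1+x]≡m-k-k*x = solve-∀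

∑-𝟙-point : ∀ {L w} → w ℕ.< L → ∑[ y < L ] 𝟙 (y ℕ.≟ w) ≡ 1
∑-𝟙-point {suc L} {zero}  _          = cong suc (∑-zero L λ y → 𝟙-no (λ ()) (suc y ℕ.≟ 0))
∑-𝟙-point {suc L} {suc w} (s≤s w<L) =
  trans (∑-cong L λ y → 𝟙-cong ℕ.suc-injective (cong suc) (suc y ℕ.≟ suc w) (y ℕ.≟ w)) (∑-𝟙-point w<L)

module _ {a b p} {A : Set a} {B : Set b} {P : Pred B p} (P? : Decidable P) where

  length-filter-map-applyUpTo : ∀ (h : A → B) (g : ℕ → A) L →
                                length (filter P? (map h (applyUpTo g L))) ≡ ∑[ z < L ] 𝟙 (P? (h (g z)))
  length-filter-map-applyUpTo h g zero = refl
  length-filter-map-applyUpTo h g (suc L) with P? (h (g 0))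
  ... | yes _ = cong suc (length-filter-map-applyUpTo h (g ∘ suc) L)
  ... | no _  = length-filter-map-applyUpTo h (g ∘ suc) L

  length-filter-concatMap-applyUpTo : ∀ (f : A → List B) (g : ℕ → A) L →
    length (filter P? (concatMap f (applyUpTo g L))) ≡ ∑[ x < L ] length (filter P? (f (g x)))
  length-filter-concatMap-applyUpTo f g zero = refl
  length-filter-concatMap-applyUpTo f g (suc L) = begin
    length (filter P? (f (g 0) ++ concatMap f (applyUpTo (g ∘ suc) L)))
      ≡⟨ cong length (filter-++ P? (f (g 0)) _) ⟩
    length (filter P? (f (g 0)) ++ filter P? (concatMap f (applyUpTo (g ∘ suc) L)))
      ≡⟨ length-++ (filter P? (f (g 0))) ⟩
    length (filter P? (f (g 0))) ℕ.+ length (filter P? (concatMap f (applyUpTo (g ∘ suc) L)))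
      ≡⟨ cong (length (filter P? (f (g 0))) ℕ.+_) (length-filter-concatMap-applyUpTo f (g ∘ suc) L) ⟩
    length (filter P? (f (g 0))) ℕ.+ ∑[ x < L ] length (filter P? (f (g (suc x))))
      ∎
    where open ≡-Reasoning

length-filter-triples : ∀ {p} {P : Pred (ℕ × ℕ × ℕ) p} (P? : Decidable P) n →
  length (filter P? (triples n)) ≡ ∑[ x < suc n ] ∑[ y < suc n ] ∑[ z < suc n ] 𝟙 (P? (x , y , z))
length-filter-triples P? n =
  trans (length-filter-concatMap-applyUpTo P? plane id (suc n)) (∑-cong (suc n) λ x →
  trans (length-filter-concatMap-applyUpTo P? (line x) id (suc n)) (∑-cong (suc n) λ y →
  length-filter-map-applyUpTo P? (λ z → x , y , z) id (suc n)))
  where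
  line : ℕ → ℕ → List (ℕ × ℕ × ℕ)
  line x y = map (λ z → x , y , z) (upTo (suc n))
  plane : ℕ → List (ℕ × ℕ × ℕ)
  plane x = concatMap (line x) (upTo (suc n))

-- Integer arithmetic

i-j≡k⇒i≡j+k : ∀ i j {k} → i - j ≡ k → i ≡ j + k
i-j≡k⇒i≡j+k i j refl = regroup i j
  where
  regroup : ∀ i j → i ≡ j + (i - j)
  regroup = solve-∀

i<j⇒1≤j-i : ∀ {i j} → i < j → 1ℤ ≤ j - i
i<j⇒1≤j-i {i} {j} i<j = subst (_≤ j - i) (cancel i) (+-monoˡ-≤ (- i) (i<j⇒suc[i]≤j i<j))
  where
  cancel : ∀ i → 1ℤ + i - i ≡ 1ℤ
  cancel = solve-∀

0≤i⇒j-i≤j : ∀ {i} j → 0ℤ ≤ i → j - i ≤ j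
0≤i⇒j-i≤j j 0≤i = subst (j - _ ≤_) (+-identityʳ j) (+-monoʳ-≤ j (neg-mono-≤ 0≤i))

0≤i⇒-k≤i-k : ∀ {i} k → 0ℤ ≤ i → - + k ≤ i - + k
0≤i⇒-k≤i-k {i} k 0≤i = subst (_≤ i - + k) (+-identityˡ (- + k)) (+-monoˡ-≤ (- + k) 0≤i)

i<j⇒i-k<j : ∀ {i j} k → i < j → i - + k < j
i<j⇒i-k<j k i<j = ≤-<-trans (i≤j⇒i-k≤j (+ k) ≤-refl) i<j

i<k*[1+x]⇒i-k<k*x : ∀ {i} k x → i < + k * + suc x → i - + k < + k * + x
i<k*[1+x]⇒i-k<k*x {i} k x i<k*[1+x] = subst (i - + k <_) (cancel (+ k) (+ x)) (+-monoˡ-< (- + k) i<k*[1+x])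
  where
  cancel : ∀ k x → k * (1ℤ + x) - k ≡ k * x
  cancel = solve-∀

m-k*x≤m : ∀ m k x → m - + k * + x ≤ m
m-k*x≤m m k x = subst (λ y → m - y ≤ m) (pos-* k x) (i≤j⇒i-k≤j (+ (k ℕ.* x)) ≤-refl)

i+k≡j⇒i-d+k≡j-d : ∀ {i j} k d → i + k ≡ j → i - d + k ≡ j - d
i+k≡j⇒i-d+k≡j-d {i} k d refl = regroup i k d
  where
  regroup : ∀ i k d → i - d + k ≡ i + k - d
  regroup = solve-∀

-m<m*t<m⇒t≡0 : ∀ m t → - + m < + m * t → + m * t < + m → t ≡ 0ℤ
-m<m*t<m⇒t≡0 m t -m<m*t m*t<m = ≤-antisym (i<j⇒i≤pred[j] t<1) (i<j⇒suc[i]≤j -1<t)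
  where
  t<1 : t < 1ℤ
  t<1 = *-cancelˡ-<-nonNeg (+ m) (subst (+ m * t <_) (sym (*-identityʳ (+ m))) m*t<m)
  -1<t : -1ℤ < t
  -1<t = *-cancelˡ-<-nonNeg (+ m) (subst (_< + m * t) (sym (trans (*-comm (+ m) -1ℤ) (-1*i≡-i (+ m)))) -m<m*t)

module _ {s m : ℕ} {x n d : ℤ} (s*x≡n+m*d : + s * x ≡ n + + m * d) where

  s*x≡n+m*d⇒x<m : n < 0ℤ → d ≤ + s → x < + m
  s*x≡n+m*d⇒x<m n<0 d≤s = *-cancelˡ-<-nonNeg (+ s) (begin-strict
    + s * x       ≡⟨ s*x≡n+m*d ⟩
    n + + m * d   <⟨ +-monoˡ-< (+ m * d) n<0 ⟩
    0ℤ + + m * d  ≡⟨ +-identityˡ (+ m * d) ⟩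
    + m * d       ≤⟨ *-monoˡ-≤-nonNeg (+ m) d≤s ⟩
    + m * + s     ≡⟨ *-comm (+ m) (+ s) ⟩
    + s * + m     ∎)
    where open ≤-Reasoning

  s*x≡n+m*d⇒-1≤x : .{{_ : Positive (+ s)}} → - + s ≤ n → 0ℤ ≤ d → -1ℤ ≤ x
  s*x≡n+m*d⇒-1≤x -s≤n 0≤d = *-cancelˡ-≤-pos -1ℤ x (+ s) (begin
    + s * -1ℤ     ≡⟨ trans (*-comm (+ s) -1ℤ) (-1*i≡-i (+ s)) ⟩
    - + s         ≤⟨ -s≤n ⟩
    n             ≡⟨ +-identityʳ n ⟨
    n + 0ℤ        ≤⟨ +-monoʳ-≤ n (subst (_≤ + m * d) (*-zeroʳ (+ m)) (*-monoˡ-≤-nonNeg (+ m) 0≤d)) ⟩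
    n + + m * d   ≡⟨ s*x≡n+m*d ⟨
    + s * x       ∎)
    where open ≤-Reasoning

  s*x≡n+m*d⇒0≤x : .{{_ : Positive (+ s)}} → - + m ≤ n → 1ℤ ≤ d → 0ℤ ≤ x
  s*x≡n+m*d⇒0≤x -m≤n 1≤d = *-cancelˡ-≤-pos 0ℤ x (+ s) (begin
    + s * 0ℤ           ≡⟨ *-zeroʳ (+ s) ⟩
    0ℤ                 ≡⟨ +-inverseˡ (+ m) ⟨
    - + m + + m        ≡⟨ cong (λ k → - + m + k) (*-identityʳ (+ m)) ⟨
    - + m + + m * 1ℤ   ≤⟨ +-mono-≤ -m≤n (*-monoˡ-≤-nonNeg (+ m) 1≤d) ⟩
    n + + m * d        ≡⟨ s*x≡n+m*d ⟨
    + s * x            ∎)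
    where open ≤-Reasoning

-- Euclidean division

record Euclid (m : ℕ) (x : ℤ) : Set where
  constructor euclid
  field
    rem quo     : ℤ
    0≤rem       : 0ℤ ≤ rem
    rem<m       : rem < + m
    x≡rem+m*quo : x ≡ rem + + m * quo

open Euclid public

quo-unique : ∀ {m x} (e e′ : Euclid m x) → quo e ≡ quo e′
quo-unique {m} (euclid r q 0≤r r<m refl) (euclid r′ q′ 0≤r′ r′<m r+mq≡r′+mq′) =
  i-j≡0⇒i≡j q q′ (-m<m*t<m⇒t≡0 m (q - q′) -m<m*[q-q′] m*[q-q′]<m)
  where
  m*[q-q′]≡r′-r : + m * (q - q′) ≡ r′ - r
  m*[q-q′]≡r′-r = begin
    + m * (q - q′)                    ≡⟨ regroup₁ (+ m) q q′ r ⟩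
    r + + m * q - + m * q′ - r        ≡⟨ cong (λ y → y - + m * q′ - r) r+mq≡r′+mq′ ⟩
    r′ + + m * q′ - + m * q′ - r      ≡⟨ regroup₂ (+ m) q′ r r′ ⟩
    r′ - r                            ∎
    where
    open ≡-Reasoning
    regroup₁ : ∀ M q q′ r → M * (q - q′) ≡ r + M * q - M * q′ - r
    regroup₁ = solve-∀
    regroup₂ : ∀ M q′ r r′ → r′ + M * q′ - M * q′ - r ≡ r′ - r
    regroup₂ = solve-∀
  m*[q-q′]<m : + m * (q - q′) < + m
  m*[q-q′]<m = subst₂ _<_ (sym m*[q-q′]≡r′-r) (+-identityʳ (+ m)) (+-mono-<-≤ r′<m (neg-mono-≤ 0≤r))
  -m<m*[q-q′] : - + m < + m * (q - q′)
  -m<m*[q-q′] = subst₂ _<_ (+-identityˡ (- + m)) (sym m*[q-q′]≡r′-r) (+-mono-≤-< 0≤r′ (neg-mono-< r<m))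

euclid-small : ∀ {m x} → 0ℤ ≤ x → x < + m → Euclid m x
euclid-small {m} {x} 0≤x x<m = euclid x 0ℤ 0≤x x<m (x≡x+m*0 x (+ m))
  where
  x≡x+m*0 : ∀ x M → x ≡ x + M * 0ℤ
  x≡x+m*0 = solve-∀

euclid-complement : ∀ {m x C} t → x ≡ (+ m - C) + + m * t → 1ℤ ≤ C → C ≤ + m → Euclid m x
euclid-complement {m} {C = C} t x≡ 1≤C C≤m = euclid (+ m - C) t (i≤j⇒0≤j-i C≤m) m-C<m x≡
  where
  m-C<m : + m - C < + m
  m-C<m = subst (+ m - C <_) (+-identityʳ (+ m)) (+-monoʳ-< (+ m) (neg-mono-< (<-≤-trans (+<+ (s≤s z≤n)) 1≤C)))

add-multiple : ∀ {m x} → Euclid m x → ∀ k → Euclid m (x + + m * k)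
add-multiple {m} (euclid r q 0≤r r<m x≡) k =
  euclid r (q + k) 0≤r r<m (trans (cong (_+ + m * k) x≡) (regroup r (+ m) q k))
  where
  regroup : ∀ r M q k → r + M * q + M * k ≡ r + M * (q + k)
  regroup = solve-∀

pred : ∀ {m x} .{{_ : NonZero m}} → Euclid m x → Euclid m (x - 1ℤ)
pred {m} (euclid (+ zero) q _ _ x≡) =
  euclid (+ m - 1ℤ) (q - 1ℤ) (i≤j⇒0≤j-i (+≤+ (ℕ.>-nonZero⁻¹ m)))
         (i≤pred[j]⇒i<j (≤-reflexive (+-comm (+ m) -1ℤ)))
    (trans (cong (_- 1ℤ) x≡) (wrap (+ m) q))
  where
  wrap : ∀ M q → 0ℤ + M * q - 1ℤ ≡ M - 1ℤ + M * (q - 1ℤ)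
  wrap = solve-∀
pred {m} (euclid (+ suc r) q _ r<m x≡) =
  euclid (+ r) q (+≤+ z≤n) (<-trans (+<+ (ℕ.n<1+n r)) r<m) (trans (cong (_- 1ℤ) x≡) (step (+ r) (+ m) q))
  where
  step : ∀ r M q → 1ℤ + r + M * q - 1ℤ ≡ r + M * q
  step = solve-∀

-- For x = rem + m quo ≥ 0 this is 2 Σ_{0 ≤ j ≤ x} ⌊j/m⌋.
floorSum : ∀ {m x} → Euclid m x → ℤ
floorSum {m} e = quo e * (+ 2 * rem e + + m * (quo e - 1ℤ) + + 2)

floorSum-pred : ∀ {m x} .{{_ : NonZero m}} (e : Euclid m x) → floorSum e ≡ floorSum (pred e) + + 2 * quo e
floorSum-pred {m} (euclid (+ zero) q _ _ _) = wrap (+ m) q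
  where
  wrap : ∀ M q → q * (+ 2 * 0ℤ + M * (q - 1ℤ) + + 2)
                 ≡ (q - 1ℤ) * (+ 2 * (M - 1ℤ) + M * (q - 1ℤ - 1ℤ) + + 2) + + 2 * q
  wrap = solve-∀
floorSum-pred {m} (euclid (+ suc r) q _ _ _) = step (+ r) (+ m) q
  where
  step : ∀ r M q → q * (+ 2 * (1ℤ + r) + M * (q - 1ℤ) + + 2) ≡ q * (+ 2 * r + M * (q - 1ℤ) + + 2) + + 2 * q
  step = solve-∀

floorSum-vanishes : ∀ {m x} .{{_ : NonZero m}} (e : Euclid m x) → -1ℤ ≤ x → x < + m → floorSum e ≡ 0ℤ
floorSum-vanishes {m} {+ k} e@(euclid r _ _ _ _) _ k<m with quo-unique e (euclid-small (+≤+ z≤n) k<m)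
... | refl = *-zeroˡ (+ 2 * r + + m * (0ℤ - 1ℤ) + + 2)
floorSum-vanishes {m} { -[1+ zero ]} e@(euclid r _ _ _ -1≡r-m) _ _
  with quo-unique e (pred (euclid-small {m} (+≤+ z≤n) (+<+ (ℕ.>-nonZero⁻¹ m))))
... | refl = trans (factor r (+ m)) (cong (λ y → -[1+ 1 ] * (y + 1ℤ)) (sym -1≡r-m))
  where
  factor : ∀ r M → -1ℤ * (+ 2 * r + M * (-1ℤ - 1ℤ) + + 2) ≡ -[1+ 1 ] * (r + M * -1ℤ + 1ℤ)
  factor = solve-∀
floorSum-vanishes { x = -[1+ suc _ ]} _ (-≤- ()) _

-- Solutions of a x + b y + (b + a) z = n

module Counting (a b : ℕ) .{{_ : NonZero a}} .{{_ : NonZero b}} (coprime : Coprime a b) where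

  c : ℕ
  c = b ℕ.+ a

  private instance
    +b-positive : Positive (+ b)
    +b-positive = positive (+<+ (ℕ.>-nonZero⁻¹ b))
    c-nonZero : NonZero c
    c-nonZero = ℕ.>-nonZero (ℕ.<-≤-trans (ℕ.>-nonZero⁻¹ b) (ℕ.m≤m+n b a))
    +c-positive : Positive (+ c)
    +c-positive = positive (+<+ (ℕ.>-nonZero⁻¹ c))

  -- The right-hand side is an integer, so that splitting off the layer x = 0 or z = 0
  -- shifts it without truncated subtraction.
  count₁ : ℕ → ℤ → ℕ
  count₁ Y m = ∑[ y < Y ] 𝟙 (+ b * + y ≟ m)

  count₂ : ℕ → ℕ → ℤ → ℕ
  count₂ X Y m = ∑[ x < X ] count₁ Y (m - + a * + x)

  count₃ : ℕ → ℕ → ℕ → ℤ → ℕ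
  count₃ X Y Z n = ∑[ z < Z ] count₂ X Y (n - + c * + z)

  count₂-suc : ∀ X Y m → count₂ (suc X) Y m ≡ count₁ Y m ℕ.+ count₂ X Y (m - + a)
  count₂-suc X Y m = ∑-peel X (count₁ Y) m (+ a)

  count₃-suc : ∀ X Y Z n → count₃ X Y (suc Z) n ≡ count₂ X Y n ℕ.+ count₃ X Y Z (n - + c)
  count₃-suc X Y Z n = ∑-peel Z (count₂ X Y) n (+ c)

  count₁-neg : ∀ Y {m} → m < 0ℤ → count₁ Y m ≡ 0
  count₁-neg Y m<0 = ∑-zero Y λ y →
    𝟙-no (λ b*y≡m → <⇒≱ m<0 (subst (0ℤ ≤_) (trans (pos-* b y) b*y≡m) (+≤+ z≤n))) _

  count₂-neg : ∀ X Y {m} → m < 0ℤ → count₂ X Y m ≡ 0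
  count₂-neg X Y {m} m<0 = ∑-zero X λ x → count₁-neg Y (≤-<-trans (m-k*x≤m m a x) m<0)

  count₃-neg : ∀ X Y Z {n} → n < 0ℤ → count₃ X Y Z n ≡ 0
  count₃-neg X Y Z {n} n<0 = ∑-zero Z λ z → count₂-neg X Y (≤-<-trans (m-k*x≤m n c z) n<0)

  count₁-b*w : ∀ Y {w} → 0ℤ ≤ w → + b * w < + b * + Y → count₁ Y (+ b * w) ≡ 1
  count₁-b*w Y {+ w} _ b*w<b*Y =
    trans (∑-cong Y λ y → 𝟙-cong (+-injective ∘ *-cancelˡ-≡ (+ b) (+ y) (+ w)) (cong (λ k → + b * + k))
                                  _ (y ℕ.≟ w))
          (∑-𝟙-point (drop‿+<+ (*-cancelˡ-<-nonNeg (+ b) b*w<b*Y)))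

  b*y≡a*[1+r]+b*w⇒b≤1+r : ∀ r w y → + b * y ≡ + a * + suc r + + b * w → b ℕ.≤ suc r
  b*y≡a*[1+r]+b*w⇒b≤1+r r w y b*y≡ =
    ∣⇒≤ (ℤ.coprime-divisor (+ b) (+ a) (+ suc r) (Coprimality.sym coprime) (Signed.∣⇒∣ᵤ b∣a*[1+r]))
    where
    b∣a*[1+r] : + b Signed.∣ + a * + suc r
    b∣a*[1+r] = Signed.∣m+n∣n⇒∣m (subst (+ b Signed.∣_) b*y≡ (Signed.∣m⇒∣m*n y Signed.∣-refl))
                                 (Signed.∣m⇒∣m*n w Signed.∣-refl)

  shift-γ : ∀ {m γ β} → m + + a * + b ≡ + a * γ + + b * β →
            m - + a + + a * + b ≡ + a * (γ - 1ℤ) + + b * β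
  shift-γ {m} {γ} {β} m+ab≡ = trans (i+k≡j⇒i-d+k≡j-d {m} (+ a * + b) (+ a) m+ab≡) (regroup (+ a) (+ b) γ β)
    where
    regroup : ∀ A B γ β → A * γ + B * β - A ≡ A * (γ - 1ℤ) + B * β
    regroup = solve-∀

  shift-γβ : ∀ {n γ β} → n + + a * + b ≡ + a * γ + + b * β →
             n - + c + + a * + b ≡ + a * (γ - 1ℤ) + + b * (β - 1ℤ)
  shift-γβ {n} {γ} {β} n+ab≡ = trans (i+k≡j⇒i-d+k≡j-d {n} (+ a * + b) (+ c) n+ab≡) (regroup (+ a) (+ b) γ β)
    where
    regroup : ∀ A B γ β → A * γ + B * β - (B + A) ≡ A * (γ - 1ℤ) + B * (β - 1ℤ)
    regroup = solve-∀

  m≡a*rem+b*y : ∀ {m γ β} (eγ : Euclid b γ) → m + + a * + b ≡ + a * γ + + b * β →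
                m ≡ + a * rem eγ + + b * (β + + a * (quo eγ - 1ℤ))
  m≡a*rem+b*y {m} {β = β} (euclid r T _ _ refl) m+ab≡ = begin
    m                                           ≡⟨ m≡m+k-k m (+ a * + b) ⟩
    m + + a * + b - + a * + b                   ≡⟨ cong (_- + a * + b) m+ab≡ ⟩
    + a * (r + + b * T) + + b * β - + a * + b   ≡⟨ regroup (+ a) (+ b) r T β ⟩
    + a * r + + b * (β + + a * (T - 1ℤ))        ∎
    where
    open ≡-Reasoning
    m≡m+k-k : ∀ m k → m ≡ m + k - k
    m≡m+k-k = solve-∀
    regroup : ∀ A B r T β → A * (r + B * T) + B * β - A * B ≡ A * r + B * (β + A * (T - 1ℤ))
    regroup = solve-∀

  -- The column x = 0 contains a solution exactly when rem eγ = 0, which is when pred lowers quo;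
  -- otherwise coprimality rules it out.
  count₁+quo-pred≡quo : ∀ Y {m γ β} (eγ : Euclid b γ) → 0ℤ ≤ m → m < + b * + Y →
                        m + + a * + b ≡ + a * γ + + b * β → + count₁ Y m + quo (pred eγ) ≡ quo eγ
  count₁+quo-pred≡quo Y {m} {β = β} eγ@(euclid (+ zero) T _ _ _) 0≤m m<b*Y m+ab≡ = begin
    + count₁ Y m + (T - 1ℤ)          ≡⟨ cong (λ k → + count₁ Y k + (T - 1ℤ)) m≡b*w ⟩
    + count₁ Y (+ b * w) + (T - 1ℤ)  ≡⟨ cong (λ k → + k + (T - 1ℤ)) (count₁-b*w Y 0≤w b*w<b*Y) ⟩
    1ℤ + (T - 1ℤ)                    ≡⟨ cancel T ⟩
    T                                ∎
    where
    open ≡-Reasoning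
    w : ℤ
    w = β + + a * (T - 1ℤ)
    m≡b*w : m ≡ + b * w
    m≡b*w = trans (m≡a*rem+b*y eγ m+ab≡) (trans (cong (_+ + b * w) (*-zeroʳ (+ a))) (+-identityˡ (+ b * w)))
    0≤w : 0ℤ ≤ w
    0≤w = *-cancelˡ-≤-pos 0ℤ w (+ b) (subst₂ _≤_ (sym (*-zeroʳ (+ b))) m≡b*w 0≤m)
    b*w<b*Y : + b * w < + b * + Y
    b*w<b*Y = subst (_< + b * + Y) m≡b*w m<b*Y
    cancel : ∀ T → 1ℤ + (T - 1ℤ) ≡ T
    cancel = solve-∀
  count₁+quo-pred≡quo Y {m} eγ@(euclid (+ suc r) T _ r<b _) _ _ m+ab≡ =
    trans (cong (λ k → + k + T) (∑-zero Y λ y → 𝟙-no (no-solution y) _)) (+-identityˡ T)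
    where
    no-solution : ∀ y → ¬ (+ b * + y ≡ m)
    no-solution y b*y≡m =
      ℕ.<⇒≱ (drop‿+<+ r<b) (b*y≡a*[1+r]+b*w⇒b≤1+r r _ (+ y) (trans b*y≡m (m≡a*rem+b*y eγ m+ab≡)))

  -- y = β + a quo eγ satisfies b y = m + a (b - rem eγ), hence 0 ≤ y < a, while quo eβ + quo eγ
  -- is its quotient by a.
  quo+quo≡0 : ∀ {m γ β} (eγ : Euclid b γ) (eβ : Euclid a β) → m + + a * + b ≡ + a * γ + + b * β →
              - + a ≤ m → m < 0ℤ → quo eγ + quo eβ ≡ 0ℤ
  quo+quo≡0 {m} {β = β} eγ@(euclid P T 0≤P P<b _) eβ m+ab≡ -a≤m m<0 = trans (+-comm T (quo eβ))
    (quo-unique (add-multiple eβ T) (euclid-small (s*x≡n+m*d⇒0≤x {s = b} {m = a} b*y≡ -a≤m (i<j⇒1≤j-i P<b))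
                                                  (s*x≡n+m*d⇒x<m {s = b} {m = a} b*y≡ m<0 (0≤i⇒j-i≤j (+ b) 0≤P))))
    where
    b*y≡ : + b * (β + + a * T) ≡ m + + a * (+ b - P)
    b*y≡ = begin
      + b * (β + + a * T)                                      ≡⟨ regroup (+ a) (+ b) P T β ⟩
      + a * P + + b * (β + + a * (T - 1ℤ)) + + a * (+ b - P)   ≡⟨ cong (_+ + a * (+ b - P)) (m≡a*rem+b*y {m} eγ m+ab≡) ⟨
      m + + a * (+ b - P)                                      ∎
      where
      open ≡-Reasoning
      regroup : ∀ A B P T β → B * (β + A * T) ≡ A * P + B * (β + A * (T - 1ℤ)) + A * (B - P)
      regroup = solve-∀

  count₂≡quo+quo : ∀ X Y {m γ β} (eγ : Euclid b γ) (eβ : Euclid a β) →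
                   m + + a * + b ≡ + a * γ + + b * β → - + a ≤ m → m < + a * + X → m < + b * + Y →
                   + count₂ X Y m ≡ quo eγ + quo eβ
  count₂≡quo+quo X Y {m} eγ eβ m+ab≡ -a≤m m<a*X m<b*Y with m <? 0ℤ
  ... | yes m<0 = trans (cong +_ (count₂-neg X Y m<0)) (sym (quo+quo≡0 eγ eβ m+ab≡ -a≤m m<0))
  count₂≡quo+quo zero Y {m} _ _ _ _ m<a*X _ | no m≮0 = contradiction (subst (m <_) (*-zeroʳ (+ a)) m<a*X) m≮0
  count₂≡quo+quo (suc X) Y {m} {γ} {β} eγ eβ m+ab≡ -a≤m m<a*X m<b*Y | no m≮0 = begin
    + count₂ (suc X) Y m                       ≡⟨ cong +_ (count₂-suc X Y m) ⟩
    + (count₁ Y m ℕ.+ count₂ X Y (m - + a))    ≡⟨ pos-+ (count₁ Y m) _ ⟩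
    + count₁ Y m + + count₂ X Y (m - + a)      ≡⟨ cong (λ k → + count₁ Y m + k) other-columns ⟩
    + count₁ Y m + (quo (pred eγ) + quo eβ)    ≡⟨ +-assoc (+ count₁ Y m) (quo (pred eγ)) (quo eβ) ⟨
    + count₁ Y m + quo (pred eγ) + quo eβ      ≡⟨ cong (_+ quo eβ) (count₁+quo-pred≡quo Y eγ 0≤m m<b*Y m+ab≡) ⟩
    quo eγ + quo eβ                            ∎
    where
    open ≡-Reasoning
    0≤m : 0ℤ ≤ m
    0≤m = ≮⇒≥ m≮0
    other-columns : + count₂ X Y (m - + a) ≡ quo (pred eγ) + quo eβ
    other-columns = count₂≡quo+quo X Y (pred eγ) eβ (shift-γ {m} m+ab≡)
      (0≤i⇒-k≤i-k a 0≤m) (i<k*[1+x]⇒i-k<k*x a X m<a*X) (i<j⇒i-k<j a m<b*Y)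

  -- c γ and c β are n plus b resp. a times a number in [0, c], hence -1 ≤ γ < b and -1 ≤ β < a.
  floorSum+floorSum≡0 : ∀ {n γ β} (eγ : Euclid b γ) (eβ : Euclid a β) → n + + a * + b ≡ + a * γ + + b * β →
                        1ℤ ≤ β - γ + + b → β - γ + + b ≤ + c → - + c ≤ n → n < 0ℤ →
                        floorSum eγ + floorSum eβ ≡ 0ℤ
  floorSum+floorSum≡0 {n} {γ} {β} eγ eβ n+ab≡ 1≤d d≤c -c≤n n<0 = cong₂ _+_
    (floorSum-vanishes eγ (s*x≡n+m*d⇒-1≤x {s = c} {m = b} c*γ≡ -c≤n (i≤j⇒0≤j-i d≤c))
                          (s*x≡n+m*d⇒x<m {s = c} {m = b} c*γ≡ n<0 (0≤i⇒j-i≤j (+ c) 0≤d)))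
    (floorSum-vanishes eβ (s*x≡n+m*d⇒-1≤x {s = c} {m = a} c*β≡ -c≤n 0≤d)
                          (s*x≡n+m*d⇒x<m {s = c} {m = a} c*β≡ n<0 d≤c))
    where
    0≤d : 0ℤ ≤ β - γ + + b
    0≤d = ≤-trans (+≤+ z≤n) 1≤d
    c*γ≡ : + c * γ ≡ n + + b * (+ c - (β - γ + + b))
    c*γ≡ = begin
      + c * γ                                  ≡⟨ regroup₁ (+ a) (+ b) γ β ⟩
      + a * γ + + b * β - + b * β + + b * γ    ≡⟨ cong (λ k → k - + b * β + + b * γ) n+ab≡ ⟨
      n + + a * + b - + b * β + + b * γ        ≡⟨ regroup₂ n (+ a) (+ b) γ β ⟩
      n + + b * (+ c - (β - γ + + b))          ∎
      where
      open ≡-Reasoning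
      regroup₁ : ∀ A B γ β → (B + A) * γ ≡ A * γ + B * β - B * β + B * γ
      regroup₁ = solve-∀
      regroup₂ : ∀ n A B γ β → n + A * B - B * β + B * γ ≡ n + B * ((B + A) - (β - γ + B))
      regroup₂ = solve-∀
    c*β≡ : + c * β ≡ n + + a * (β - γ + + b)
    c*β≡ = begin
      + c * β                                  ≡⟨ regroup₁ (+ a) (+ b) γ β ⟩
      + a * γ + + b * β - + a * γ + + a * β    ≡⟨ cong (λ k → k - + a * γ + + a * β) n+ab≡ ⟨
      n + + a * + b - + a * γ + + a * β        ≡⟨ regroup₂ n (+ a) (+ b) γ β ⟩
      n + + a * (β - γ + + b)                  ∎
      where
      open ≡-Reasoning
      regroup₁ : ∀ A B γ β → (B + A) * β ≡ A * γ + B * β - A * γ + A * β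
      regroup₁ = solve-∀
      regroup₂ : ∀ n A B γ β → n + A * B - A * γ + A * β ≡ n + A * (β - γ + B)
      regroup₂ = solve-∀

  2*count₃≡floorSum+floorSum : ∀ X Y Z {n γ β} (eγ : Euclid b γ) (eβ : Euclid a β) →
    n + + a * + b ≡ + a * γ + + b * β → 1ℤ ≤ β - γ + + b → β - γ + + b ≤ + c → - + c ≤ n →
    n < + a * + X → n < + b * + Y → n < + c * + Z →
    + 2 * + count₃ X Y Z n ≡ floorSum eγ + floorSum eβ
  2*count₃≡floorSum+floorSum X Y Z {n} eγ eβ n+ab≡ 1≤d d≤c -c≤n _ _ _ with n <? 0ℤ
  ... | yes n<0 = trans (cong (λ k → + 2 * + k) (count₃-neg X Y Z n<0))
                        (sym (floorSum+floorSum≡0 eγ eβ n+ab≡ 1≤d d≤c -c≤n n<0))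
  2*count₃≡floorSum+floorSum X Y zero {n} _ _ _ _ _ _ _ _ n<c*Z | no n≮0 =
    contradiction (subst (n <_) (*-zeroʳ (+ c)) n<c*Z) n≮0
  2*count₃≡floorSum+floorSum X Y (suc Z) {n} {γ} {β} eγ eβ n+ab≡ 1≤d d≤c -c≤n n<a*X n<b*Y n<c*Z | no n≮0 = begin
    + 2 * + count₃ X Y (suc Z) n
      ≡⟨ cong (λ k → + 2 * + k) (count₃-suc X Y Z n) ⟩
    + 2 * + (count₂ X Y n ℕ.+ count₃ X Y Z (n - + c))
      ≡⟨ cong (+ 2 *_) (pos-+ (count₂ X Y n) _) ⟩
    + 2 * (+ count₂ X Y n + + count₃ X Y Z (n - + c))
      ≡⟨ *-distribˡ-+ (+ 2) (+ count₂ X Y n) _ ⟩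
    + 2 * + count₂ X Y n + + 2 * + count₃ X Y Z (n - + c)
      ≡⟨ cong₂ _+_ (cong (+ 2 *_) bottom-layer) upper-layers ⟩
    + 2 * (quo eγ + quo eβ) + (floorSum (pred eγ) + floorSum (pred eβ))
      ≡⟨ regroup (quo eγ) (quo eβ) (floorSum (pred eγ)) (floorSum (pred eβ)) ⟩
    (floorSum (pred eγ) + + 2 * quo eγ) + (floorSum (pred eβ) + + 2 * quo eβ)
      ≡⟨ cong₂ _+_ (floorSum-pred eγ) (floorSum-pred eβ) ⟨
    floorSum eγ + floorSum eβ
      ∎
    where
    open ≡-Reasoning
    0≤n : 0ℤ ≤ n
    0≤n = ≮⇒≥ n≮0
    bottom-layer : + count₂ X Y n ≡ quo eγ + quo eβ
    bottom-layer = count₂≡quo+quo X Y eγ eβ n+ab≡ (≤-trans (neg-mono-≤ (+≤+ z≤n)) 0≤n) n<a*X n<b*Y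
    d-invariant : β - 1ℤ - (γ - 1ℤ) + + b ≡ β - γ + + b
    d-invariant = cancel β γ (+ b)
      where
      cancel : ∀ β γ B → β - 1ℤ - (γ - 1ℤ) + B ≡ β - γ + B
      cancel = solve-∀
    upper-layers : + 2 * + count₃ X Y Z (n - + c) ≡ floorSum (pred eγ) + floorSum (pred eβ)
    upper-layers = 2*count₃≡floorSum+floorSum X Y Z (pred eγ) (pred eβ) (shift-γβ {n} n+ab≡)
      (subst (1ℤ ≤_) (sym d-invariant) 1≤d) (subst (_≤ + c) (sym d-invariant) d≤c)
      (0≤i⇒-k≤i-k c 0≤n) (i<j⇒i-k<j c n<a*X) (i<j⇒i-k<j c n<b*Y) (i<k*[1+x]⇒i-k<k*x c Z n<c*Z)
    regroup : ∀ q q′ f f′ → + 2 * (q + q′) + (f + f′) ≡ (f + + 2 * q) + (f′ + + 2 * q′)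
    regroup = solve-∀

  pos-a*x+b*y+c*z : ∀ x y z → + (a ℕ.* x ℕ.+ b ℕ.* y ℕ.+ c ℕ.* z) ≡ + a * + x + + b * + y + + c * + z
  pos-a*x+b*y+c*z x y z = begin
    + (a ℕ.* x ℕ.+ b ℕ.* y ℕ.+ c ℕ.* z)       ≡⟨ pos-+ (a ℕ.* x ℕ.+ b ℕ.* y) (c ℕ.* z) ⟩
    + (a ℕ.* x ℕ.+ b ℕ.* y) + + (c ℕ.* z)     ≡⟨ cong (_+ + (c ℕ.* z)) (pos-+ (a ℕ.* x) (b ℕ.* y)) ⟩
    + (a ℕ.* x) + + (b ℕ.* y) + + (c ℕ.* z)   ≡⟨ cong₂ _+_ (cong₂ _+_ (pos-* a x) (pos-* b y)) (pos-* c z) ⟩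
    + a * + x + + b * + y + + c * + z         ∎
    where open ≡-Reasoning

  𝟙-a*x+b*y+c*z≟n : ∀ n x y z →
    𝟙 (a ℕ.* x ℕ.+ b ℕ.* y ℕ.+ c ℕ.* z ℕ.≟ n) ≡ 𝟙 (+ b * + y ≟ + n - + c * + z - + a * + x)
  𝟙-a*x+b*y+c*z≟n n x y z = 𝟙-cong isolate restore _ _
    where
    isolate-y : ∀ u v w → v ≡ u + v + w - w - u
    isolate-y = solve-∀
    add-back : ∀ u w n → u + (n - w - u) + w ≡ n
    add-back = solve-∀
    isolate : a ℕ.* x ℕ.+ b ℕ.* y ℕ.+ c ℕ.* z ≡ n → + b * + y ≡ + n - + c * + z - + a * + x
    isolate eq = trans (isolate-y (+ a * + x) (+ b * + y) (+ c * + z))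
      (cong (λ k → k - + c * + z - + a * + x) (trans (sym (pos-a*x+b*y+c*z x y z)) (cong +_ eq)))
    restore : + b * + y ≡ + n - + c * + z - + a * + x → a ℕ.* x ℕ.+ b ℕ.* y ℕ.+ c ℕ.* z ≡ n
    restore eq = +-injective (trans (pos-a*x+b*y+c*z x y z)
      (trans (cong (λ k → + a * + x + k + + c * + z) eq) (add-back (+ a * + x) (+ c * + z) (+ n))))

  N≡count₃ : ∀ n → N a b c n ≡ count₃ (suc n) (suc n) (suc n) (+ n)
  N≡count₃ n = begin
    N a b c n
      ≡⟨ length-filter-triples (λ { (x , y , z) → solution? x y z }) n ⟩
    ∑[ x < suc n ] ∑[ y < suc n ] ∑[ z < suc n ] 𝟙 (solution? x y z)
      ≡⟨ ∑-cong (suc n) (λ x → ∑-comm (suc n) (suc n) (λ y z → 𝟙 (solution? x y z))) ⟩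
    ∑[ x < suc n ] ∑[ z < suc n ] ∑[ y < suc n ] 𝟙 (solution? x y z)
      ≡⟨ ∑-comm (suc n) (suc n) (λ x z → ∑[ y < suc n ] 𝟙 (solution? x y z)) ⟩
    ∑[ z < suc n ] ∑[ x < suc n ] ∑[ y < suc n ] 𝟙 (solution? x y z)
      ≡⟨ ∑-cong (suc n) (λ z → ∑-cong (suc n) λ x → ∑-cong (suc n) λ y → 𝟙-a*x+b*y+c*z≟n n x y z) ⟩
    count₃ (suc n) (suc n) (suc n) (+ n)
      ∎
    where
    open ≡-Reasoning
    solution? : ∀ x y z → Dec (a ℕ.* x ℕ.+ b ℕ.* y ℕ.+ c ℕ.* z ≡ n)
    solution? x y z = a ℕ.* x ℕ.+ b ℕ.* y ℕ.+ c ℕ.* z ℕ.≟ n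

  -- The third coefficient is any c′ equal to c, so that callers can pass it in their own
  -- syntactic form: conversion checking through N or ℤ._*_ is too expensive to rely on.
  2*N≡floorSum+floorSum : ∀ {c′} → c′ ≡ c → ∀ n {γ β} (eγ : Euclid b γ) (eβ : Euclid a β) →
    + n + + a * + b ≡ + a * γ + + b * β → 1ℤ ≤ β - γ + + b → β - γ + + b ≤ + c →
    + 2 * + N a b c′ n ≡ floorSum eγ + floorSum eβ
  2*N≡floorSum+floorSum refl n eγ eβ n+ab≡ 1≤d d≤c = trans (cong (λ k → + 2 * + k) (N≡count₃ n))
    (2*count₃≡floorSum+floorSum (suc n) (suc n) (suc n) eγ eβ n+ab≡ 1≤d d≤c
      (≤-trans (neg-mono-≤ (+≤+ z≤n)) (+≤+ z≤n)) (n<k*[1+n] a) (n<k*[1+n] b) (n<k*[1+n] c))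
    where
    n<k*[1+n] : ∀ k .{{_ : NonZero k}} → + n < + k * + suc n
    n<k*[1+n] k = subst (+ n <_) (pos-* k (suc n)) (+<+ (ℕ.<-≤-trans (ℕ.n<1+n n) (ℕ.m≤n*m (suc n) k)))

-- A, B and C are separate from + a, + b and + c for the same reason as c′ above.
closed-form : ∀ {a b c n solutions : ℕ} {A B C B₁ C₂ A₃ γ β : ℤ} (eγ : Euclid b γ) (eβ : Euclid a β) →
  A ≡ + a → B ≡ + b → C ≡ + c → c ≡ b ℕ.+ a →
  rem eγ ≡ + b - C₂ → rem eβ ≡ + a - B₁ → A₃ ≡ β - γ + + b → + n + + a * + b ≡ + a * γ + + b * β →
  + 2 * + solutions ≡ floorSum eγ + floorSum eβ →
  let N₂ = + n * (+ n + A + B + C)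
           + C * B * B₁ * (A + + 1 - (B₁ - + 1))
           + A * C * C₂ * (B + + 1 - (C₂ - + 1))
           + B * A * A₃ * (C + + 1 - (C - + 1) * (A₃ - + 1))
  in + 2 * A * B * C * (+ solutions + + 2) ≡ N₂ + A * B * C * ((A₃ - + 1) * (A₃ - + 2))
closed-form {a} {b} {n = n} {solutions} {B₁ = B₁} {C₂} eγ@(euclid _ T _ _ refl) eβ@(euclid _ U _ _ refl)
  refl refl refl refl refl refl refl n+ab≡ 2*s≡ = begin
  + 2 * A * B * C * (+ solutions + + 2)          ≡⟨ regroup A B (+ solutions) ⟩
  A * B * C * (+ 2 * + solutions + + 4)          ≡⟨ cong (λ t → A * B * C * (t + + 4)) 2*s≡ ⟩
  A * B * C * (floorSum eγ + floorSum eβ + + 4)  ≡⟨ identity A B C₂ B₁ T U ⟩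
  rhs (A * γ + B * β - A * B)                    ≡⟨ cong rhs (trans (sym (cancel (+ n) (A * B))) (cong (_- A * B) n+ab≡)) ⟨
  rhs (+ n)                                      ∎
  where
  open ≡-Reasoning
  A B C γ β : ℤ
  A = + a
  B = + b
  C = B + A
  γ = B - C₂ + B * T
  β = A - B₁ + A * U
  rhs : ℤ → ℤ
  rhs ν = let A₃ = β - γ + B in
    ν * (ν + A + B + C) + C * B * B₁ * (A + + 1 - (B₁ - + 1)) + A * C * C₂ * (B + + 1 - (C₂ - + 1))
    + B * A * A₃ * (C + + 1 - (C - + 1) * (A₃ - + 1)) + A * B * C * ((A₃ - + 1) * (A₃ - + 2))
  regroup : ∀ A B s → + 2 * A * B * (B + A) * (s + + 2) ≡ A * B * (B + A) * (+ 2 * s + + 4)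
  regroup = solve-∀
  cancel : ∀ n k → n + k - k ≡ n
  cancel = solve-∀
  identity : ∀ A B C₂ B₁ T U →
    let C = B + A
        γ = B - C₂ + B * T
        β = A - B₁ + A * U
        ν = A * γ + B * β - A * B
        A₃ = β - γ + B
    in A * B * C * (T * (+ 2 * (B - C₂) + B * (T - 1ℤ) + + 2) + U * (+ 2 * (A - B₁) + A * (U - 1ℤ) + + 2) + + 4)
       ≡ ν * (ν + A + B + C) + C * B * B₁ * (A + + 1 - (B₁ - + 1)) + A * C * C₂ * (B + + 1 - (C₂ - + 1))
         + B * A * A₃ * (C + + 1 - (C - + 1) * (A₃ - + 1)) + A * B * C * ((A₃ - + 1) * (A₃ - + 2))
  identity = solve-∀

-- Fibonacci numbers

fib-nonZero : ∀ k → NonZero (fib (suc k))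
fib-nonZero zero    = _
fib-nonZero (suc k) = ℕ.>-nonZero (ℕ.<-≤-trans (ℕ.>-nonZero⁻¹ (fib (suc k)) {{fib-nonZero k}}) (ℕ.m≤m+n _ _))

fib-coprime : ∀ k → Coprime (fib k) (fib (suc k))
fib-coprime zero    = Coprimality.sym (Coprimality.1-coprimeTo 0)
fib-coprime (suc k) = Coprimality.sym (Coprimality.coprime-+ (fib-coprime k))

sgn-square : ∀ i → sgn i * sgn i ≡ 1ℤ
sgn-square zero    = refl
sgn-square (suc i) = trans (neg-square (sgn i)) (sgn-square i)
  where
  neg-square : ∀ s → - s * - s ≡ s * s
  neg-square = solve-∀

cassini : ∀ j → F (suc (suc j)) * (F (suc (suc j)) - F (suc j)) - F (suc j) * F (suc j) ≡ sgn (suc j)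
cassini zero    = refl
cassini (suc j) = trans (step (F j) (F (suc j))) (cong -_ (cassini j))
  where
  step : ∀ x y → (y + x + y) * (y + x + y - (y + x)) - (y + x) * (y + x) ≡ - ((y + x) * (y + x - y) - y * y)
  step = solve-∀

Fm2+F≡F+F : ∀ j → Fm2 (suc j) + F (suc (suc j)) ≡ F (suc j) + F (suc j)
Fm2+F≡F+F zero    = refl
Fm2+F≡F+F (suc j) = step (F j) (F (suc j))
  where
  step : ∀ x y → x + (y + x + y) ≡ (y + x) + (y + x)
  step = solve-∀

-- With b (b - a) - a² = s and s² = 1, the quotients of the three congruences give γ and β explicitly.
module CassiniDecomposition (a b : ℕ) {s f : ℤ}
  (cassini : + b * (+ b - + a) - + a * + a ≡ s) (s²≡1 : s * s ≡ 1ℤ) (f+b≡a+a : f + + b ≡ + a + + a)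
  (n : ℕ) (B₁ C₂ A₃ : ℤ)
  (a∣B₁′ : + a ∣ B₁ - s * + n * f) (1≤B₁ : 1ℤ ≤ B₁) (B₁≤a : B₁ ≤ + a)
  (b∣C₂′ : + b ∣ C₂ - s * + n * + a) (1≤C₂ : 1ℤ ≤ C₂) (C₂≤b : C₂ ≤ + b)
  (c∣A₃′ : + b + + a ∣ A₃ - s * + n * + b) where

  open Signed._∣_ (Signed.∣ᵤ⇒∣ {+ a} {B₁ - s * + n * f} a∣B₁′) renaming (quotient to qB; equality to eqB)
  open Signed._∣_ (Signed.∣ᵤ⇒∣ {+ b} {C₂ - s * + n * + a} b∣C₂′) renaming (quotient to qC; equality to eqC)
  open Signed._∣_ (Signed.∣ᵤ⇒∣ {+ b + + a} {A₃ - s * + n * + b} c∣A₃′) renaming (quotient to qA; equality to eqA)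

  γ β : ℤ
  γ = + b - s * + a * + n - + b * qA
  β = s * (+ b - + a) * + n + + a * qA

  n+ab≡aγ+bβ : + n + + a * + b ≡ + a * γ + + b * β
  n+ab≡aγ+bβ = begin
    + n + + a * + b                                         ≡⟨ regroup₁ (+ n) (+ a) (+ b) ⟩
    + a * + b + 1ℤ * + n                                    ≡⟨ cong (λ t → + a * + b + t * + n) s²≡1 ⟨
    + a * + b + s * s * + n                                 ≡⟨ regroup₂ (+ a) (+ b) s (+ n) ⟩
    + a * + b + s * + n * s                                 ≡⟨ cong (λ t → + a * + b + s * + n * t) cassini ⟨
    + a * + b + s * + n * (+ b * (+ b - + a) - + a * + a)   ≡⟨ regroup₃ (+ a) (+ b) s (+ n) qA ⟩
    + a * γ + + b * β                                       ∎
    where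
    open ≡-Reasoning
    regroup₁ : ∀ n A B → n + A * B ≡ A * B + 1ℤ * n
    regroup₁ = solve-∀
    regroup₂ : ∀ A B s n → A * B + s * s * n ≡ A * B + s * n * s
    regroup₂ = solve-∀
    regroup₃ : ∀ A B s n qA → A * B + s * n * (B * (B - A) - A * A)
                              ≡ A * (B - s * A * n - B * qA) + B * (s * (B - A) * n + A * qA)
    regroup₃ = solve-∀

  A₃≡β-γ+b : A₃ ≡ β - γ + + b
  A₃≡β-γ+b = trans (i-j≡k⇒i≡j+k A₃ (s * + n * + b) eqA) (regroup (+ a) (+ b) s (+ n) qA)
    where
    regroup : ∀ A B s n qA → s * n * B + qA * (B + A) ≡ (s * (B - A) * n + A * qA) - (B - s * A * n - B * qA) + B
    regroup = solve-∀

  eγ : Euclid b γ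
  eγ = euclid-complement (qC - qA) γ≡ 1≤C₂ C₂≤b
    where
    open ≡-Reasoning
    regroup : ∀ A B s n qA qC → B - s * A * n - B * qA ≡ B - (s * n * A + qC * B) + B * (qC - qA)
    regroup = solve-∀
    γ≡ : γ ≡ (+ b - C₂) + + b * (qC - qA)
    γ≡ = begin
      γ
        ≡⟨ regroup (+ a) (+ b) s (+ n) qA qC ⟩
      + b - (s * + n * + a + qC * + b) + + b * (qC - qA)
        ≡⟨ cong (λ t → + b - t + + b * (qC - qA)) (i-j≡k⇒i≡j+k C₂ (s * + n * + a) eqC) ⟨
      + b - C₂ + + b * (qC - qA)
        ∎

  eβ : Euclid a β
  eβ = euclid-complement U β≡ 1≤B₁ B₁≤a
    where
    open ≡-Reasoning
    U : ℤ
    U = s * + n + qA + qB - 1ℤ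
    a-f≡b-a : + a - f ≡ + b - + a
    a-f≡b-a = begin
      + a - f                                   ≡⟨ regroup₁ (+ a) (+ b) f ⟩
      (+ a + + a) - (f + + b) + (+ b - + a)     ≡⟨ cong (λ t → (+ a + + a) - t + (+ b - + a)) f+b≡a+a ⟩
      (+ a + + a) - (+ a + + a) + (+ b - + a)   ≡⟨ regroup₂ (+ a + + a) (+ b - + a) ⟩
      + b - + a                                 ∎
      where
      regroup₁ : ∀ A B f → A - f ≡ (A + A) - (f + B) + (B - A)
      regroup₁ = solve-∀
      regroup₂ : ∀ x y → x - x + y ≡ y
      regroup₂ = solve-∀
    regroup : ∀ A s n f qA qB → s * (A - f) * n + A * qA ≡ A - (s * n * f + qB * A) + A * (s * n + qA + qB - 1ℤ)
    regroup = solve-∀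
    β≡ : β ≡ (+ a - B₁) + + a * U
    β≡ = begin
      β
        ≡⟨ cong (λ t → s * t * + n + + a * qA) a-f≡b-a ⟨
      s * (+ a - f) * + n + + a * qA
        ≡⟨ regroup (+ a) s (+ n) f qA qB ⟩
      + a - (s * + n * f + qB * + a) + + a * U
        ≡⟨ cong (λ t → + a - t + + a * U) (i-j≡k⇒i≡j+k B₁ (s * + n * f) eqB) ⟨
      + a - B₁ + + a * U
        ∎

theorem4 : (i n : ℕ) → i ≥ 1 → n ≥ 1 →
    (B₁ C₂ A₃ : ℤ) →
    F i ∣ (B₁ - sgn i * + n * Fm2 i) → + 1 ≤ B₁ → B₁ ≤ F i →
    F (ℕ.suc i) ∣ (C₂ - sgn i * + n * F i) → + 1 ≤ C₂ → C₂ ≤ F (ℕ.suc i) →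
    F (ℕ.suc (ℕ.suc i)) ∣ (A₃ - sgn i * + n * F (ℕ.suc i)) → + 1 ≤ A₃ → A₃ ≤ F (ℕ.suc (ℕ.suc i)) →
    let a = F i
        b = F (ℕ.suc i)
        c = F (ℕ.suc (ℕ.suc i))
        N₂ = + n * (+ n + a + b + c)
             + c * b * B₁ * (a + + 1 - (B₁ - + 1))
             + a * c * C₂ * (b + + 1 - (C₂ - + 1))
             + b * a * A₃ * (c + + 1 - (c - + 1) * (A₃ - + 1))
    in
    -- N = N₂ / (2abc) + (A₃-1)(A₃-2)/2 - 2, with denominators cleared
    + 2 * a * b * c * (+ N (fib i) (fib (ℕ.suc i)) (fib (ℕ.suc (ℕ.suc i))) n + + 2)
      ≡ N₂ + a * b * c * ((A₃ - + 1) * (A₃ - + 2))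
theorem4 (suc j) n _ _ B₁ C₂ A₃ a∣B₁′ 1≤B₁ B₁≤a b∣C₂′ 1≤C₂ C₂≤b c∣A₃′ 1≤A₃ A₃≤c =
  closed-form {A = F (suc j)} {F (suc (suc j))} {F (suc (suc (suc j)))} eγ eβ refl refl refl refl refl refl
    A₃≡β-γ+b n+ab≡aγ+bβ (2*N≡floorSum+floorSum {c′ = fib (suc (suc (suc j)))} refl n eγ eβ n+ab≡aγ+bβ
                          (subst (1ℤ ≤_) A₃≡β-γ+b 1≤A₃) (subst (_≤ F (suc (suc (suc j)))) A₃≡β-γ+b A₃≤c))
  where
  instance
    _ = fib-nonZero j
    _ = fib-nonZero (suc j)
  open Counting (fib (suc j)) (fib (suc (suc j))) (fib-coprime (suc j))
  open CassiniDecomposition (fib (suc j)) (fib (suc (suc j))) (cassini j) (sgn-square (suc j)) (Fm2+F≡F+F j)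
                            n B₁ C₂ A₃ a∣B₁′ 1≤B₁ B₁≤a b∣C₂′ 1≤C₂ C₂≤b c∣A₃′
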